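{- Let $b \geq d \geq D \geq 1$ be integers with $b \geq 2$, $d > 1$, and $\beta := b - D \geq 2$, and let $c(x) := c_{b,\beta}(x/d)$ for $x \in \mathbb{Q}_{\geq 0}$. If $d \leq b - 2$ and $D \leq b/2$, then $c(1) \geq \dfrac{D}{\beta(\beta - 1)}$.
   Context: For a base $b \geq 2$, each real $x \geq 0$ has a unique normal base-$b$ expansion $x = \sum_i x_i b^i$ (digits in $\{0,\dots,b-1\}$, $x_i=0$ for $i\gg0$, not ending in infinitely many digits $b-1$). The $(b,\beta)$-content is $c_{b,\beta}(x) := \sum_i x_i \beta^i$. -}

module Defs where

open import Data.Nat as ℕ using (ℕ; zero; suc; _^_)
import Data.Nat.DivMod as ℕD
open import Data.Integer using (+_)
open import Data.Rational using (ℚ; 0ℚ; _+_; _*_; _-_; _<_)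
import Data.Rational as ℚ
open import Data.Product using (∃)

-- Total natural-number division / remainder (value 0 when dividing by 0;
-- that case never arises below since b ≥ 2 and q ≥ 1 where it is used).
divℕ : ℕ → ℕ → ℕ
divℕ a zero    = 0
divℕ a (suc n) = a ℕD./ suc n

modℕ : ℕ → ℕ → ℕ
modℕ a zero    = 0
modℕ a (suc n) = a ℕD.% suc n

-- the rational a / n (0 if n = 0; never used with n = 0 below)
frac : ℕ → ℕ → ℚ
frac a zero    = 0ℚ
frac a (suc n) = (+ a) ℚ./ suc n

-- Normal base-b digits of the nonnegative rational x = p / q (q ≥ 1):
--   digit at position i ≥ 0 :  ⌊ p / (q b^i) ⌋ mod b
--   digit at position -k (k ≥ 1) : ⌊ p b^k / q ⌋ mod b
-- (the greedy expansion, which is the normal one: it never ends in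
--  infinitely many digits b-1).
digitPos : (b p q i : ℕ) → ℕ
digitPos b p q i = modℕ (divℕ p (q ℕ.* b ^ i)) b

digitNeg : (b p q k : ℕ) → ℕ
digitNeg b p q k = modℕ (divℕ (p ℕ.* b ^ k) q) b

posPart : (b β p q n : ℕ) → ℚ
posPart b β p q zero    = 0ℚ
posPart b β p q (suc n) =
  posPart b β p q n + frac (digitPos b p q n ℕ.* β ^ n) 1

negPart : (b β p q N : ℕ) → ℚ
negPart b β p q zero    = 0ℚ
negPart b β p q (suc N) =
  negPart b β p q N + frac (digitNeg b p q (suc N)) (β ^ suc N)

-- Partial sum of c_{b,β}(p/q) over positions -N .. p.
-- All digits at positions i > p vanish (b^i > p since b ≥ 2),
-- so the nonnegative-index part is complete.
partialContent : (b β p q N : ℕ) → ℚ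
partialContent b β p q N = posPart b β p q (suc p) + negPart b β p q N

-- c_{b,β}(p/q) ≥ L, where c_{b,β}(p/q) is the (convergent, nonnegative-term)
-- series Σ_i x_i β^i, i.e. the supremum/limit of its partial sums:
-- for every ε > 0 some partial sum exceeds L - ε.
ContentGE : (b β p q : ℕ) → ℚ → Set
ContentGE b β p q L =
  ∀ (ε : ℚ) → 0ℚ < ε → ∃ λ N → L - ε < partialContent b β p q N

-- The content of 1/d is at least its two leading fractional terms x₋₁/β + x₋₂/β², where
-- x₋₁ = ⌊b/d⌋ and x₋₂ = ⌊b²/d⌋ mod b. Since 2D ≤ b gives D ≤ β and (β + 2)(β − 1) ≥ β² ≥ Dβ,
-- it suffices that x₋₁β + x₋₂ ≥ β + 2. Now x₋₁ ≥ 1 as d ≤ b, and either x₋₁ ≥ 2, or b < 2d;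
-- in the latter case d ≤ b − 2 gives b + 2 ≤ ⌊b²/d⌋ < 2b, so x₋₂ = ⌊b²/d⌋ − b ≥ 2.

module Submission where

open import Defs
open import Data.Nat as ℕ
  using (ℕ; zero; suc; _+_; _*_; _∸_; _^_; _/_; _%_; _≤_; _<_; _≥_; s≤s; z≤n; NonZero)
import Data.Nat.Properties as ℕP
open import Data.Nat.DivMod
  using (m/n<m; m<n⇒m%n≡m; m≥n⇒m/n>0; m≤n⇒[n∸m]%m≡n%m; /-monoˡ-≤; m*n/n≡m; m<n*o⇒m/o<n)
open import Data.Nat.Tactic.RingSolver using (solve-∀)
open import Data.Integer as ℤ using (+_)
import Data.Integer.Properties as ℤP
open import Data.Rational as ℚ using (0ℚ)
import Data.Rational.Properties as ℚP
open import Data.Rational.Unnormalised as ℚᵘ using (mkℚᵘ; *≤*)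
import Data.Rational.Unnormalised.Properties as ℚᵘP
open import Data.Product using (_,_)
open import Data.Sum using (_⊎_; inj₁; inj₂)
open import Relation.Nullary using (yes; no)
open import Relation.Binary.PropositionalEquality

pos-cross-sum : ∀ b c m n o →
  + ((b * o + c * n) * m) ≡ (+ b ℤ.* + o ℤ.+ + c ℤ.* + n) ℤ.* + m
pos-cross-sum b c m n o = begin
  + ((b * o + c * n) * m)                  ≡⟨ ℤP.pos-* (b * o + c * n) m ⟩
  + (b * o + c * n) ℤ.* + m                ≡⟨ cong (ℤ._* + m) (ℤP.pos-+ (b * o) (c * n)) ⟩
  (+ (b * o) ℤ.+ + (c * n)) ℤ.* + m        ≡⟨ cong₂ (λ x y → (x ℤ.+ y) ℤ.* + m) (ℤP.pos-* b o) (ℤP.pos-* c n) ⟩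
  (+ b ℤ.* + o ℤ.+ + c ℤ.* + n) ℤ.* + m    ∎
  where open ≡-Reasoning

frac-≤-+ : ∀ a b c m n o →
  a * (suc n * suc o) ≤ (b * suc o + c * suc n) * suc m →
  frac a (suc m) ℚ.≤ frac b (suc n) ℚ.+ frac c (suc o)
frac-≤-+ a b c m n o h = ℚP.toℚᵘ-cancel-≤ (begin
  ℚ.toℚᵘ (frac a (suc m))                     ≃⟨ ℚP.toℚᵘ-fromℚᵘ (mkℚᵘ (+ a) m) ⟩
  mkℚᵘ (+ a) m                               ≤⟨ *≤* (subst₂ ℤ._≤_ (ℤP.pos-* a _) (pos-cross-sum b c _ _ _) (ℤ.+≤+ h)) ⟩
  mkℚᵘ (+ b) n ℚᵘ.+ mkℚᵘ (+ c) o              ≃⟨ ℚᵘP.≃-sym sum≃ ⟩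
  ℚ.toℚᵘ (frac b (suc n) ℚ.+ frac c (suc o))  ∎)
  where
  open ℚᵘP.≤-Reasoning
  sum≃ : ℚ.toℚᵘ (frac b (suc n) ℚ.+ frac c (suc o)) ℚᵘ.≃ mkℚᵘ (+ b) n ℚᵘ.+ mkℚᵘ (+ c) o
  sum≃ = ℚᵘP.≃-trans (ℚP.toℚᵘ-homo-+ (frac b (suc n)) (frac c (suc o)))
           (ℚᵘP.+-cong (ℚP.toℚᵘ-fromℚᵘ (mkℚᵘ (+ b) n)) (ℚP.toℚᵘ-fromℚᵘ (mkℚᵘ (+ c) o)))

frac-nonneg : ∀ a n → 0ℚ ℚ.≤ frac a n
frac-nonneg a zero    = ℚP.≤-refl
frac-nonneg a (suc n) = ℚP.nonNegative⁻¹ _ {{ℚP.normalize-nonNeg a (suc n)}}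

posPart-nonneg : ∀ b β p q n → 0ℚ ℚ.≤ posPart b β p q n
posPart-nonneg b β p q zero    = ℚP.≤-refl
posPart-nonneg b β p q (suc n) = begin
  0ℚ                                       ≡⟨ ℚP.+-identityʳ 0ℚ ⟨
  0ℚ ℚ.+ 0ℚ                                 ≤⟨ ℚP.+-mono-≤ (posPart-nonneg b β p q n) (frac-nonneg x 1) ⟩
  posPart b β p q n ℚ.+ frac x 1           ∎
  where
  open ℚP.≤-Reasoning
  x = digitPos b p q n * β ^ n

negPart≤partialContent : ∀ b β p q N → negPart b β p q N ℚ.≤ partialContent b β p q N
negPart≤partialContent b β p q N = begin
  negPart b β p q N                             ≡⟨ ℚP.+-identityˡ _ ⟨
  0ℚ ℚ.+ negPart b β p q N                      ≤⟨ ℚP.+-monoˡ-≤ (negPart b β p q N) (posPart-nonneg b β p q (suc p)) ⟩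
  posPart b β p q (suc p) ℚ.+ negPart b β p q N  ∎
  where open ℚP.≤-Reasoning

negPart-two : ∀ b β p q →
  negPart b β p q 2 ≡ frac (digitNeg b p q 1) (β ^ 1) ℚ.+ frac (digitNeg b p q 2) (β ^ 2)
negPart-two b β p q =
  cong (ℚ._+ frac (digitNeg b p q 2) (β ^ 2)) (ℚP.+-identityˡ (frac (digitNeg b p q 1) (β ^ 1)))

≤-partialContent⇒ContentGE : ∀ b β p q {L} N → L ℚ.≤ partialContent b β p q N → ContentGE b β p q L
≤-partialContent⇒ContentGE b β p q {L} N L≤S ε ε>0 = N , ℚP.<-≤-trans L-ε<L L≤S
  where
  L-ε<L : L ℚ.- ε ℚ.< L
  L-ε<L = subst (L ℚ.- ε ℚ.<_) (ℚP.+-identityʳ L) (ℚP.+-monoʳ-< L (ℚP.neg-antimono-< ε>0))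

twoDigits⇒ContentGE : ∀ b β p q {L} →
  L ℚ.≤ frac (digitNeg b p q 1) (β ^ 1) ℚ.+ frac (digitNeg b p q 2) (β ^ 2) → ContentGE b β p q L
twoDigits⇒ContentGE b β p q {L} h = ≤-partialContent⇒ContentGE b β p q 2 (begin
  L                                                                      ≤⟨ h ⟩
  frac (digitNeg b p q 1) (β ^ 1) ℚ.+ frac (digitNeg b p q 2) (β ^ 2)    ≡⟨ negPart-two b β p q ⟨
  negPart b β p q 2                                                      ≤⟨ negPart≤partialContent b β p q 2 ⟩
  partialContent b β p q 2                                               ∎)
  where open ℚP.≤-Reasoning

frac-≤-twoDigits : ∀ k (let β = suc (suc k)) D x₁ x₂ →
  D * β ≤ (x₁ * β + x₂) * suc k → frac D (β * suc k) ℚ.≤ frac x₁ (β ^ 1) ℚ.+ frac x₂ (β ^ 2)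
frac-≤-twoDigits k D x₁ x₂ h = frac-≤-+ D x₁ x₂ _ _ _
  (subst₂ _≤_ (scaleˡ D β) (scaleʳ x₁ x₂ β (suc k)) (ℕP.*-monoˡ-≤ (β * β) h))
  where
  β = suc (suc k)
  -- β ^ 1 and β ^ 2 are spelled out as the products they compute to, for the ring solver.
  scaleˡ : ∀ D β → (D * β) * (β * β) ≡ D * ((β * 1) * (β * (β * 1)))
  scaleˡ = solve-∀
  scaleʳ : ∀ x₁ x₂ β m → ((x₁ * β + x₂) * m) * (β * β) ≡ (x₁ * (β * (β * 1)) + x₂ * (β * 1)) * (β * m)
  scaleʳ = solve-∀

2*n≡n+n : ∀ n → 2 * n ≡ n + n
2*n≡n+n n = cong (λ m → n + m) (ℕP.+-identityʳ n)

n≤m<n+n⇒m%n≡m∸n : ∀ {m n} .{{_ : NonZero n}} → n ≤ m → m < n + n → m % n ≡ m ∸ n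
n≤m<n+n⇒m%n≡m∸n {m} {n} n≤m m<2n =
  trans (sym (m≤n⇒[n∸m]%m≡n%m n≤m)) (m<n⇒m%n≡m (ℕP.m<n+o⇒m∸n<o m n m<2n))

d+2≤b⇒[b+2]*d≤b*b : ∀ {b d} → d + 2 ≤ b → (b + 2) * d ≤ b * b
d+2≤b⇒[b+2]*d≤b*b {b} {d} d+2≤b =
  subst (λ b → (b + 2) * d ≤ b * b) (ℕP.m+[n∸m]≡n d+2≤b)
    (ℕP.≤-trans (ℕP.m≤m+n _ _) (ℕP.≤-reflexive (expand d (b ∸ (d + 2)))))
  where
  expand : ∀ d e → (d + 2 + e + 2) * d + (4 + e * d + 4 * e + e * e) ≡ (d + 2 + e) * (d + 2 + e)
  expand = solve-∀

reciprocal-secondDigit≥2 : ∀ {b d} .{{_ : NonZero b}} .{{_ : NonZero d}} →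
  d + 2 ≤ b → b < d + d → 2 ≤ b * b / d % b
reciprocal-secondDigit≥2 {b} {d} d+2≤b b<2d = begin
  2               ≡⟨ ℕP.m+n∸m≡n b 2 ⟨
  b + 2 ∸ b       ≤⟨ ℕP.∸-monoˡ-≤ b b+2≤q ⟩
  q ∸ b           ≡⟨ n≤m<n+n⇒m%n≡m∸n (ℕP.≤-trans (ℕP.m≤m+n b 2) b+2≤q) q<2b ⟨
  q % b           ∎
  where
  open ℕP.≤-Reasoning
  q = b * b / d
  b+2≤q : b + 2 ≤ q
  b+2≤q = subst (_≤ q) (m*n/n≡m (b + 2) d) (/-monoˡ-≤ d (d+2≤b⇒[b+2]*d≤b*b d+2≤b))
  b*2d≡2b*d : b * (d + d) ≡ (b + b) * d
  b*2d≡2b*d = trans (ℕP.*-distribˡ-+ b d d) (sym (ℕP.*-distribʳ-+ d b b))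
  q<2b : q < b + b
  q<2b = m<n*o⇒m/o<n (subst (b * b <_) b*2d≡2b*d (ℕP.*-monoʳ-< b b<2d))

reciprocal-leadingDigits : ∀ {b d} .{{_ : NonZero b}} .{{_ : NonZero d}} →
  d + 2 ≤ b → 2 ≤ b / d ⊎ 2 ≤ b * b / d % b
reciprocal-leadingDigits {b} {d} d+2≤b with b ℕ.<? d + d
... | yes b<2d = inj₂ (reciprocal-secondDigit≥2 d+2≤b b<2d)
... | no  b≮2d = inj₁ (subst (_≤ b / d) (m*n/n≡m 2 d)
                        (/-monoˡ-≤ d (subst (_≤ b) (sym (2*n≡n+n d)) (ℕP.≮⇒≥ b≮2d))))

digitNeg-reciprocal₁ : ∀ b' d' (let b = suc b'; d = suc d') → 1 < d → digitNeg b 1 d 1 ≡ b / d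
digitNeg-reciprocal₁ b' d' 1<d =
  trans (cong (λ n → n / suc d' % suc b') (trans (ℕP.*-identityˡ _) (ℕP.*-identityʳ (suc b'))))
        (m<n⇒m%n≡m (m/n<m (suc b') (suc d') 1<d))

digitNeg-reciprocal₂ : ∀ b' d' (let b = suc b'; d = suc d') → digitNeg b 1 d 2 ≡ b * b / d % b
digitNeg-reciprocal₂ b' d' =
  cong (λ n → n / suc d' % suc b') (trans (ℕP.*-identityˡ _) (cong (suc b' *_) (ℕP.*-identityʳ (suc b'))))

β+2≤x₁*β+x₂ : ∀ β {x₁ x₂} → 2 ≤ β → 1 ≤ x₁ → 2 ≤ x₁ ⊎ 2 ≤ x₂ → β + 2 ≤ x₁ * β + x₂
β+2≤x₁*β+x₂ β {x₁} {x₂} 2≤β 1≤x₁ (inj₁ 2≤x₁) = begin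
  β + 2        ≤⟨ ℕP.+-monoʳ-≤ β 2≤β ⟩
  β + β        ≡⟨ 2*n≡n+n β ⟨
  2 * β        ≤⟨ ℕP.*-monoˡ-≤ β 2≤x₁ ⟩
  x₁ * β       ≤⟨ ℕP.m≤m+n (x₁ * β) x₂ ⟩
  x₁ * β + x₂  ∎
  where open ℕP.≤-Reasoning
β+2≤x₁*β+x₂ β {x₁} 2≤β 1≤x₁ (inj₂ 2≤x₂) = ℕP.+-mono-≤ (ℕP.m≤n*m β x₁ {{ℕ.>-nonZero 1≤x₁}}) 2≤x₂

D*β≤[x₁*β+x₂]*[β∸1] : ∀ k D x₁ x₂ (let β = suc (suc k)) →
  D ≤ β → β + 2 ≤ x₁ * β + x₂ → D * β ≤ (x₁ * β + x₂) * suc k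
D*β≤[x₁*β+x₂]*[β∸1] k D x₁ x₂ D≤β β+2≤s = begin
  D * β              ≤⟨ ℕP.*-monoˡ-≤ β D≤β ⟩
  β * β              ≤⟨ ℕP.m≤m+n (β * β) k ⟩
  β * β + k          ≡⟨ expand k ⟨
  (β + 2) * suc k    ≤⟨ ℕP.*-monoˡ-≤ (suc k) β+2≤s ⟩
  (x₁ * β + x₂) * suc k  ∎
  where
  open ℕP.≤-Reasoning
  β = suc (suc k)
  expand : ∀ k → (suc (suc k) + 2) * suc k ≡ suc (suc k) * suc (suc k) + k
  expand = solve-∀

reciprocal-ContentGE : ∀ b' d' k D (let b = suc b'; d = suc d'; β = suc (suc k)) →
  D ≤ β → 1 < d → d + 2 ≤ b → ContentGE b β 1 d (frac D (β * suc k))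
reciprocal-ContentGE b' d' k D D≤β 1<d d+2≤b =
  twoDigits⇒ContentGE b β 1 d
    (frac-≤-twoDigits k D x₁ x₂ (D*β≤[x₁*β+x₂]*[β∸1] k D x₁ x₂ D≤β β+2≤x₁β+x₂))
  where
  b = suc b'
  d = suc d'
  β = suc (suc k)
  x₁ = digitNeg b 1 d 1
  x₂ = digitNeg b 1 d 2
  β+2≤x₁β+x₂ : β + 2 ≤ x₁ * β + x₂
  β+2≤x₁β+x₂ rewrite digitNeg-reciprocal₁ b' d' 1<d | digitNeg-reciprocal₂ b' d' =
    β+2≤x₁*β+x₂ β (s≤s (s≤s z≤n)) (m≥n⇒m/n>0 (ℕP.m+n≤o⇒m≤o d d+2≤b))
      (reciprocal-leadingDigits d+2≤b)

corollary8p10 : (b d D : ℕ) →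
    b ≥ d → d ≥ D → D ≥ 1 → b ≥ 2 → 1 < d → (b ∸ D) ≥ 2 →
    d ≤ b ∸ 2 → 2 * D ≤ b →
    ContentGE b (b ∸ D) 1 d (frac D ((b ∸ D) * ((b ∸ D) ∸ 1)))
corollary8p10 (suc b') (suc d') D _ _ _ b≥2 1<d β≥2 d≤b∸2 2D≤b
  with suc b' ∸ D in b∸D≡β | β≥2
... | suc zero    | s≤s ()
... | suc (suc k) | _ = reciprocal-ContentGE b' d' k D D≤β 1<d (ℕP.m≤o∸n⇒m+n≤o (suc d') b≥2 d≤b∸2)
  where
  D≤β : D ≤ suc (suc k)
  D≤β = subst (D ≤_) b∸D≡β
    (ℕP.m+n≤o⇒m≤o∸n D (subst (_≤ suc b') (2*n≡n+n D) 2D≤b))
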